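{- Let $\mathcal I$ be a small step alternating pushdown system and $\overline{\mathcal I}$ its complementation (defined below). A configuration has a co-inductive proof in $\overline{\mathcal I}$ if and only if it has no proof in $\mathcal I$.
   Context: Fix a language with finitely many unary predicate symbols (states), finitely many unary function symbols (stack symbols), a constant $\varepsilon$ and a variable $x$. Words are closed terms $\gamma_1(\cdots\gamma_n(\varepsilon))$; configurations are atomic propositions $P(w)$ with $P$ a state and $w$ a word. For an inference system $\mathcal J$ (a set of rules $\frac{A_1\cdots A_n}{B}$ with atomic premises and conclusion, possibly containing $x$): a proof of a configuration $A$ is a finite tree labeled by configurations with root $A$ such that each node is labeled $\sigma B$ and its children $\sigma A_1,\dots,\sigma A_n$ for some rule $\frac{A_1\cdots A_n}{B}\in\mathcal J$ and some substitution $\sigma$ of a word for $x$; a co-inductive proof is the same except that the tree may be finite or infinite. Rule types: an introduction rule is $\frac{P_1(x)\cdots P_n(x)}{Q(\gamma x)}$ ($\gamma$ a stack symbol, $n\ge0$) or $\frac{}{Q(\varepsilon)}$; an elimination rule is $\frac{P_1(\gamma x)\ P_2(x)\cdots P_n(x)}{Q(x)}$ ($n\ge1$); a neutral rule is $\frac{P_1(x)\cdots P_n(x)}{Q(x)}$ ($n\ge0$). A small step alternating pushdown system is a finite set of introduction, elimination and neutral rules. $\tilde{\mathcal I}$ is obtained from $\mathcal I$ by keeping the introduction rules and replacing each neutral or elimination rule (with conclusion $P(x)$) by its instance with $x:=\varepsilon$ and, for each stack symbol $\gamma$, its instance with $x:=\gamma x$. Let $\mathcal C$ be the set of all $P(\varepsilon)$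 and $P(\gamma x)$. The complementation $\overline{\mathcal I}$: for each $B\in\mathcal C$, if $r_1,\dots,r_n$ ($n\ge0$) are the rules of $\tilde{\mathcal I}$ with conclusion $B$, $r_i$ having premises $A^i_1,\dots,A^i_{m_i}$, then $\overline{\mathcal I}$ contains the rules $\frac{A^1_{j_1}\ \cdots\ A^n_{j_n}}{B}$ for all choices $1\le j_i\le m_i$ (the single rule $\frac{}{B}$ if $n=0$). -}

module Defs where

open import Data.Nat using (ℕ)
open import Data.Fin using (Fin)
open import Data.Fin.Properties using () renaming (_≟_ to _≟F_)
open import Data.List using (List; []; _∷_; [_]; _++_; map; concatMap; filter; length; lookup; allFin)
open import Data.List.Membership.Propositional using (_∈_)
open import Data.List.Properties using (≡-dec)
open import Data.Product using (Σ; _×_; _,_; proj₁; proj₂)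
open import Relation.Nullary using (Dec; yes; no)
open import Relation.Nullary.Decidable using (map′; _×-dec_)
open import Relation.Binary.PropositionalEquality using (_≡_; refl; cong)

module APDS (nS nG : ℕ) where

  -- states (unary predicate symbols) and stack symbols (unary function symbols)
  State : Set
  State = Fin nS

  Sym : Set
  Sym = Fin nG

  -- a word γ₁(⋯γₙ(ε)) is the list [γ₁ , … , γₙ] (head = outermost symbol)
  Word : Set
  Word = List Sym

  Config : Set
  Config = State × Word

  -- terms possibly containing the variable x:
  --   cl w  is the closed term w
  --   ap w  is the term γ₁(⋯γₙ(x)) for w = [γ₁ , … , γₙ]
  data Term : Set where
    cl : Word → Term
    ap : Word → Term

  Atom : Set
  Atom = State × Term

  record Rule : Set where
    constructor mkRule
    field
      premises : List Atom
      concl    : Atom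
  open Rule public

  System : Set
  System = List Rule

  instT : Word → Term → Word
  instT σ (cl w) = w
  instT σ (ap w) = w ++ σ

  inst : Word → Atom → Config
  inst σ (P , t) = P , instT σ t

  data Subst : Set where
    x≔ε  : Subst
    x≔γx : Sym → Subst

  substT : Subst → Term → Term
  substT s (cl w) = cl w
  substT x≔ε (ap w) = cl w
  substT (x≔γx γ) (ap w) = ap (w ++ [ γ ])

  substA : Subst → Atom → Atom
  substA s (P , t) = P , substT s t

  substR : Subst → Rule → Rule
  substR s r = mkRule (map (substA s) (premises r)) (substA s (concl r))

  data Proof (J : System) : Config → Set where
    node : (r : Rule) → r ∈ J → (σ : Word) →
           ((i : Fin (length (premises r))) → Proof J (inst σ (lookup (premises r) i))) →
           Proof J (inst σ (concl r))

  -- co-inductive proofs (finite or infinite trees), presented by their set of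
  -- nodes: each node carries a label, a rule of J and a substitution for x such
  -- that the label is the instance of the conclusion and the children are
  -- labelled by the corresponding instances of the premises.
  record CoProof (J : System) (A : Config) : Set₁ where
    field
      Node   : Set
      root   : Node
      label  : Node → Config
      rule   : Node → Rule
      ruleIn : (n : Node) → rule n ∈ J
      subst  : Node → Word
      child  : (n : Node) → Fin (length (premises (rule n))) → Node
      rootLabel  : label root ≡ A
      nodeLabel  : (n : Node) → label n ≡ inst (subst n) (concl (rule n))
      childLabel : (n : Node) (i : Fin (length (premises (rule n)))) →
                   label (child n i) ≡ inst (subst n) (lookup (premises (rule n)) i)

  data SRule : Set where
    -- P₁(x) ⋯ Pₙ(x) / Q(γ x)
    introγ  : List State → Sym → State → SRule
    -- / Q(ε)
    introε  : State → SRule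
    -- P₁(γ x) P₂(x) ⋯ Pₙ(x) / Q(x)
    elim    : State → Sym → List State → State → SRule
    -- P₁(x) ⋯ Pₙ(x) / Q(x)
    neutral : List State → State → SRule

  atX : State → Atom
  atX P = P , ap []

  toRule : SRule → Rule
  toRule (introγ ps γ Q)   = mkRule (map atX ps) (Q , ap [ γ ])
  toRule (introε Q)        = mkRule [] (Q , cl [])
  toRule (elim P₁ γ ps Q)  = mkRule ((P₁ , ap [ γ ]) ∷ map atX ps) (atX Q)
  toRule (neutral ps Q)    = mkRule (map atX ps) (atX Q)

  SmallStepAPDS : Set
  SmallStepAPDS = List SRule

  ⟦_⟧ : SmallStepAPDS → System
  ⟦ I ⟧ = map toRule I

  allSubst : List Subst
  allSubst = x≔ε ∷ map x≔γx (allFin nG)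

  tildeR : SRule → List Rule
  tildeR r@(introγ _ _ _) = [ toRule r ]
  tildeR r@(introε _)     = [ toRule r ]
  tildeR r@(elim _ _ _ _) = map (λ s → substR s (toRule r)) allSubst
  tildeR r@(neutral _ _)  = map (λ s → substR s (toRule r)) allSubst

  tilde : SmallStepAPDS → System
  tilde I = concatMap tildeR I

  𝒞 : List Atom
  𝒞 = concatMap (λ P → (P , cl []) ∷ map (λ γ → P , ap [ γ ]) (allFin nG)) (allFin nS)

  _≟T_ : (s t : Term) → Dec (s ≡ t)
  cl v ≟T cl w = map′ (cong cl) (λ { refl → refl }) (≡-dec _≟F_ v w)
  cl v ≟T ap w = no (λ ())
  ap v ≟T cl w = no (λ ())
  ap v ≟T ap w = map′ (cong ap) (λ { refl → refl }) (≡-dec _≟F_ v w)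

  _≟A_ : (a b : Atom) → Dec (a ≡ b)
  (P , s) ≟A (Q , t) = map′ (λ { (refl , refl) → refl }) (λ { refl → refl , refl }) ((P ≟F Q) ×-dec (s ≟T t))

  choices : {A : Set} → List (List A) → List (List A)
  choices []       = [ [] ]
  choices (l ∷ ls) = concatMap (λ a → map (a ∷_) (choices ls)) l

  complement : SmallStepAPDS → System
  complement I = concatMap
    (λ B → map (λ ps → mkRule ps B)
               (choices (map premises (filter (λ r → concl r ≟A B) (tilde I)))))
    𝒞

module Submission where

-- By construction every rule of Ī with conclusion B shares a
-- premise with every rule of Ĩ with conclusion B, and any choice of one premise
-- from each Ĩ-rule with conclusion B ∈ 𝒞 forms a rule of Ī.  Every instance of
-- a rule of J is covered by an instance of a rule of Ĩ concluding an element of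
-- 𝒞, and the rules of Ĩ are admissible in J.
--
--  (⇒) a co-inductive Ī-proof refutes every J-proof: by induction on a J-proof
--      of the label of a node, some child is labelled by one of its premises;
--  (⇐) the unprovable configurations form a co-inductive Ī-proof, since a
--      Ĩ-rule with an unprovable conclusion has an unprovable premise.
--
-- Choosing the unprovable premise in (⇐) needs provability in J to be
-- decidable.  This is shown first, by saturation: the states provable at γ w
-- depend only on those provable at w, and closing a set of states under the
-- neutral and elimination rules is a least fixed point over the finite space
-- of such sets, reached by Kleene iteration.

open import Defs
open import Data.Nat using (ℕ; zero; suc; _+_; _≤_; _<_; s≤s; z≤n)
open import Data.Nat.Properties using (≤-trans; m≤n⇒m≤1+n; <⇒≱; +-suc; +-monoʳ-≤; m≤m+n; module ≤-Reasoning)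
open import Data.Bool using (Bool; true; false; T; if_then_else_; _∧_; _∨_)
import Data.Bool.Properties as Bool
open import Data.Empty using (⊥; ⊥-elim)
open import Data.Fin using (Fin; zero; suc)
open import Data.Fin.Properties using (_≟_)
open import Data.List using (List; []; _∷_; [_]; _++_; map; filter; length; lookup; allFin; cartesianProduct)
open import Data.Bool.ListAction using (all; any)
open import Data.List.Properties using (++-identityʳ; ++-assoc)
open import Data.List.Membership.Propositional using (_∈_; find; lose)
open import Data.List.Membership.Propositional.Properties using (∈-map⁺; ∈-map⁻; ∈-++⁺ˡ; ∈-++⁺ʳ; ∈-concatMap⁺; ∈-concatMap⁻; ∈-filter⁺; ∈-filter⁻; ∈-allFin; ∈-lookup; ∈-cartesianProduct⁺)
open import Data.List.Relation.Unary.All using (All; []; _∷_; all?)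
import Data.List.Relation.Unary.All as All
import Data.List.Relation.Unary.All.Properties as All
open import Data.List.Relation.Unary.All.Properties.Core using (¬All⇒Any¬)
open import Data.List.Relation.Unary.Any using (Any; here; there; index)
open import Data.List.Relation.Unary.Any.Properties using (any⁺; any⁻; lookup-index)
open import Data.Vec using (Vec; tabulate)
import Data.Vec as Vec
open import Data.Vec.Properties using (lookup∘tabulate)
open import Data.Product using (Σ; ∃; _×_; _,_; proj₁; proj₂)
open import Data.Sum using (inj₁; inj₂)
open import Function.Bundles using (_⇔_; mk⇔; Equivalence)
open import Relation.Nullary using (¬_; Dec; yes; no)
open import Relation.Nullary.Decidable using (⌊_⌋; toWitness; fromWitness; T?; map′)
open import Relation.Binary.PropositionalEquality using (_≡_; refl; sym; trans; cong; subst; module ≡-Reasoning)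

module KleeneIteration {X : Set} (xs : List X) (enumerates : ∀ x → x ∈ xs)
  (F : (X → Bool) → X → Bool) (inflationary : ∀ D x → T (D x) → T (F D x)) where

  size : (X → Bool) → List X → ℕ
  size D []       = 0
  size D (x ∷ ys) = (if D x then 1 else 0) + size D ys

  size-bounded : ∀ D ys → size D ys ≤ length ys
  size-bounded D [] = z≤n
  size-bounded D (x ∷ ys) with D x
  ... | true  = s≤s (size-bounded D ys)
  ... | false = m≤n⇒m≤1+n (size-bounded D ys)

  size-mono : ∀ D ys → size D ys ≤ size (F D) ys
  size-mono D [] = z≤n
  size-mono D (x ∷ ys) with D x | F D x | inflationary D x
  ... | true  | true  | _   = s≤s (size-mono D ys)
  ... | true  | false | inf = ⊥-elim (inf _)
  ... | false | true  | _   = m≤n⇒m≤1+n (size-mono D ys)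
  ... | false | false | _   = size-mono D ys

  size-strict : ∀ D ys → Any (λ x → ¬ F D x ≡ D x) ys → size D ys < size (F D) ys
  size-strict D (x ∷ ys) (here changed) with D x | F D x | inflationary D x
  ... | true  | true  | _   = ⊥-elim (changed refl)
  ... | true  | false | inf = ⊥-elim (inf _)
  ... | false | true  | _   = s≤s (size-mono D ys)
  ... | false | false | _   = ⊥-elim (changed refl)
  size-strict D (x ∷ ys) (there changed) with D x | F D x | inflationary D x
  ... | true  | true  | _   = s≤s (size-strict D ys changed)
  ... | true  | false | inf = ⊥-elim (inf _)
  ... | false | true  | _   = m≤n⇒m≤1+n (size-strict D ys changed)
  ... | false | false | _   = size-strict D ys changed

  Stable : (X → Bool) → Set
  Stable D = All (λ x → F D x ≡ D x) xs

  stable? : ∀ D → Dec (Stable D)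
  stable? D = all? (λ x → F D x Bool.≟ D x) xs

  iterate : ℕ → (X → Bool) → X → Bool
  iterate zero    D = D
  iterate (suc n) D with stable? D
  ... | yes _ = D
  ... | no  _ = iterate n (F D)

  -- every unstable step increases size, which is bounded by length xs
  iterate-stable : ∀ n D → length xs < n + size D xs → Stable (iterate n D)
  iterate-stable zero    D bound = ⊥-elim (<⇒≱ bound (size-bounded D xs))
  iterate-stable (suc n) D bound with stable? D
  ... | yes stable   = stable
  ... | no  unstable = iterate-stable n (F D) (≤-trans bound (begin
    suc n + size D xs   ≡⟨ sym (+-suc n (size D xs)) ⟩
    n + suc (size D xs) ≤⟨ +-monoʳ-≤ n (size-strict D xs changed) ⟩
    n + size (F D) xs   ∎))
    where
      open ≤-Reasoning
      changed : Any (λ x → ¬ F D x ≡ D x) xs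
      changed = ¬All⇒Any¬ (λ x → F D x Bool.≟ D x) xs unstable

  iterate-preserves : (Pr : (X → Bool) → Set) → (∀ {D} → Pr D → Pr (F D)) →
                      ∀ n D → Pr D → Pr (iterate n D)
  iterate-preserves Pr pres zero    D pr = pr
  iterate-preserves Pr pres (suc n) D pr with stable? D
  ... | yes _ = pr
  ... | no  _ = iterate-preserves Pr pres n (F D) (pres pr)

  lfp : (X → Bool) → X → Bool
  lfp D₀ = iterate (suc (length xs)) D₀

  lfp-closed : ∀ D₀ x → T (F (lfp D₀) x) → T (lfp D₀ x)
  lfp-closed D₀ x = subst T (All.lookup stable (enumerates x))
    where
      stable : Stable (lfp D₀)
      stable = iterate-stable (suc (length xs)) D₀ (s≤s (m≤m+n (length xs) (size D₀ xs)))

  lfp-induction : (Pr : (X → Bool) → Set) → (∀ {D} → Pr D → Pr (F D)) →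
                  ∀ D₀ → Pr D₀ → Pr (lfp D₀)
  lfp-induction Pr pres = iterate-preserves Pr pres (suc (length xs))

allSubsets : (n : ℕ) → List (Vec Bool n)
allSubsets zero    = [ Vec.[] ]
allSubsets (suc n) = map (true Vec.∷_) (allSubsets n) ++ map (false Vec.∷_) (allSubsets n)

allSubsets-complete : ∀ {n} (U : Vec Bool n) → U ∈ allSubsets n
allSubsets-complete Vec.[]          = here refl
allSubsets-complete (true Vec.∷ U)  = ∈-++⁺ˡ (∈-map⁺ (true Vec.∷_) (allSubsets-complete U))
allSubsets-complete {suc n} (false Vec.∷ U) =
  ∈-++⁺ʳ (map (true Vec.∷_) (allSubsets n)) (∈-map⁺ (false Vec.∷_) (allSubsets-complete U))

≟-refl : ∀ {n} (i : Fin n) → T ⌊ i ≟ i ⌋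
≟-refl i = fromWitness {a? = i ≟ i} refl

∧-intro : ∀ {a b} → T a → T b → T (a ∧ b)
∧-intro ta tb = Equivalence.from Bool.T-∧ (ta , tb)

∧-elim : ∀ a {b} → T (a ∧ b) → T a × T b
∧-elim a = Equivalence.to (Bool.T-∧ {a})

≟-∧-elim : ∀ {n} (i j : Fin n) {b} → T (⌊ i ≟ j ⌋ ∧ b) → i ≡ j × T b
≟-∧-elim i j t with i ≟ j
... | yes i≡j = i≡j , t
... | no  _   = ⊥-elim t

All-fromIndexed : ∀ {A : Set} {P : A → Set} (xs : List A) → ((i : Fin (length xs)) → P (lookup xs i)) → All P xs
All-fromIndexed []       f = []
All-fromIndexed (x ∷ xs) f = f zero ∷ All-fromIndexed xs (λ i → f (suc i))

module Complementation (nS nG : ℕ) where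
  open APDS nS nG

  choice-meets : ∀ {A : Set} (ls : List (List A)) {c l} → c ∈ choices ls → l ∈ ls → ∃ λ a → a ∈ l × a ∈ c
  choice-meets (l₀ ∷ ls) c∈ l∈ with find (∈-concatMap⁻ (λ a → map (a ∷_) (choices ls)) {xs = l₀} c∈)
  ... | a , a∈l₀ , c∈′ with ∈-map⁻ (a ∷_) c∈′ | l∈
  ... | c′ , c′∈ , refl | here refl = a , a∈l₀ , here refl
  ... | c′ , c′∈ , refl | there l∈ls with choice-meets ls c′∈ l∈ls
  ...   | b , b∈l , b∈c′ = b , b∈l , there b∈c′

  choices-complete : ∀ {A : Set} {P : A → Set} (ls : List (List A)) →
                     All (λ l → ∃ λ a → a ∈ l × P a) ls → ∃ λ c → c ∈ choices ls × All P c
  choices-complete []       []                        = [] , here refl , []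
  choices-complete (l ∷ ls) ((a , a∈l , pa) ∷ rest) with choices-complete ls rest
  ... | c , c∈ , pc =
    a ∷ c , ∈-concatMap⁺ (λ a → map (a ∷_) (choices ls)) {xs = l} (lose a∈l (∈-map⁺ (a ∷_) c∈)) , pa ∷ pc

  module _ (I : SmallStepAPDS) where

    J : System
    J = ⟦ I ⟧

    infer : ∀ {s} → s ∈ I → (σ : Word) → All (λ a → Proof J (inst σ a)) (premises (toRule s)) →
            Proof J (inst σ (concl (toRule s)))
    infer {s} s∈I σ subproofs =
      node (toRule s) (∈-map⁺ toRule s∈I) σ (λ i → All.lookup subproofs (∈-lookup i))

    witness : ∀ {p : SRule → Bool} {X : Set} → (∀ {s} → s ∈ I → T (p s) → X) → T (any p I) → X
    witness {p} k t with find (any⁻ p I t)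
    ... | s , s∈I , ps = k s∈I ps

    by-rule : ∀ {p : SRule → Bool} {s} → s ∈ I → T (p s) → T (any p I)
    by-rule {p} s∈I ps = any⁺ p (lose s∈I ps)

    StateSet : Set
    StateSet = Vec Bool nS

    infix 4 _∋_
    _∋_ : StateSet → State → Set
    U ∋ P = T (Vec.lookup U P)

    ∋-tabulate : ∀ {f : State → Bool} {Q} → tabulate f ∋ Q → T (f Q)
    ∋-tabulate {f} {Q} = subst T (lookup∘tabulate f Q)

    tabulate-∋ : ∀ {f : State → Bool} {Q} → T (f Q) → tabulate f ∋ Q
    tabulate-∋ {f} {Q} = subst T (sym (lookup∘tabulate f Q))

    Sound : StateSet → Word → Set
    Sound U w = ∀ P → U ∋ P → Proof J (P , w)

    introducesε : State → SRule → Bool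
    introducesε Q (introε Q′) = ⌊ Q′ ≟ Q ⌋
    introducesε Q _           = false

    introducesγ : Sym → StateSet → State → SRule → Bool
    introducesγ γ U Q (introγ ps γ′ Q′) = ⌊ γ′ ≟ γ ⌋ ∧ ⌊ Q′ ≟ Q ⌋ ∧ all (Vec.lookup U) ps
    introducesγ γ U Q _                 = false

    atε : StateSet
    atε = tabulate (λ Q → any (introducesε Q) I)

    push : Sym → StateSet → StateSet
    push γ U = tabulate (λ Q → any (introducesγ γ U Q) I)

    atε-sound : Sound atε []
    atε-sound Q t = witness rule-sound (∋-tabulate t)
      where
        rule-sound : ∀ {s} → s ∈ I → T (introducesε Q s) → Proof J (Q , [])
        rule-sound {introε Q′} s∈I eq with toWitness eq
        ... | refl = infer s∈I [] []

    atX-sound : ∀ {w} (f : State → Bool) → (∀ P → T (f P) → Proof J (P , w)) →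
                ∀ ps → T (all f ps) → All (λ a → Proof J (inst w a)) (map atX ps)
    atX-sound f sound ps t = All.map⁺ (All.map (λ {P} → sound P) (All.all⁺ f ps t))

    push-sound : ∀ γ {U w} → Sound U w → Sound (push γ U) (γ ∷ w)
    push-sound γ {U} {w} sound Q t = witness rule-sound (∋-tabulate t)
      where
        rule-sound : ∀ {s} → s ∈ I → T (introducesγ γ U Q s) → Proof J (Q , γ ∷ w)
        rule-sound {introγ ps γ′ Q′} s∈I t with ≟-∧-elim γ′ γ t
        ... | refl , t′ with ≟-∧-elim Q′ Q t′
        ... | refl , inU = infer s∈I w (atX-sound (Vec.lookup U) sound ps inU)

    -- a closure operator candidate: D (U , Q) says that Q is derivable at a
    -- word from the set U of states introduced there, by neutral and
    -- elimination rules
    Closure : Set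
    Closure = StateSet × State → Bool

    infix 10 _⟨_⟩
    _⟨_⟩ : Closure → StateSet → StateSet
    D ⟨ U ⟩ = tabulate (λ Q → D (U , Q))

    -- whether a neutral or elimination rule derives Q from U given D; an
    -- elimination rule consults D at γ w, whose introduced states are push γ (D ⟨ U ⟩)
    fires : Closure → StateSet → State → SRule → Bool
    fires D U Q (neutral ps Q′)   = ⌊ Q′ ≟ Q ⌋ ∧ all (λ P → D (U , P)) ps
    fires D U Q (elim P₁ γ ps Q′) = ⌊ Q′ ≟ Q ⌋ ∧ D (push γ (D ⟨ U ⟩) , P₁) ∧ all (λ P → D (U , P)) ps
    fires D U Q _                 = false

    step : Closure → Closure
    step D (U , Q) = D (U , Q) ∨ any (fires D U Q) I

    SoundClosure : Closure → Set
    SoundClosure D = ∀ {U w} → Sound U w → Sound (D ⟨ U ⟩) w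

    step-sound : ∀ {D} → SoundClosure D → SoundClosure (step D)
    step-sound {D} soundD {U} {w} sound Q t with Equivalence.to Bool.T-∨ (∋-tabulate t)
    ... | inj₁ old = soundD sound Q (tabulate-∋ old)
    ... | inj₂ new = witness rule-sound new
      where
        soundAt : ∀ P → T (D (U , P)) → Proof J (P , w)
        soundAt P t = soundD sound P (tabulate-∋ t)

        rule-sound : ∀ {s} → s ∈ I → T (fires D U Q s) → Proof J (Q , w)
        rule-sound {neutral ps Q′} s∈I t with ≟-∧-elim Q′ Q t
        ... | refl , inD = infer s∈I w (atX-sound (λ P → D (U , P)) soundAt ps inD)
        rule-sound {elim P₁ γ ps Q′} s∈I t with ≟-∧-elim Q′ Q t
        ... | refl , t′ with ∧-elim (D (push γ (D ⟨ U ⟩) , P₁)) t′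
        ... | inPushed , inD =
          infer s∈I w (soundD (push-sound γ (soundD sound)) P₁ (tabulate-∋ inPushed)
                       ∷ atX-sound (λ P → D (U , P)) soundAt ps inD)

    module Saturation = KleeneIteration
      (cartesianProduct (allSubsets nS) (allFin nS))
      (λ (U , Q) → ∈-cartesianProduct⁺ (allSubsets-complete U) (∈-allFin Q))
      step (λ D (U , Q) t → Equivalence.from Bool.T-∨ (inj₁ t))

    closure : Closure
    closure = Saturation.lfp (λ (U , Q) → Vec.lookup U Q)

    closure-sound : SoundClosure closure
    closure-sound = Saturation.lfp-induction SoundClosure step-sound _
      (λ sound Q t → sound Q (∋-tabulate t))

    closure-extends : ∀ {U Q} → U ∋ Q → closure ⟨ U ⟩ ∋ Q
    closure-extends t = tabulate-∋ (Saturation.lfp-induction Extends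
      (λ ext t → Equivalence.from Bool.T-∨ (inj₁ (ext t))) _ (λ t → t) t)
      where
        Extends : Closure → Set
        Extends D = ∀ {U Q} → U ∋ Q → T (D (U , Q))

    closure-closed : ∀ {U Q s} → s ∈ I → T (fires closure U Q s) → closure ⟨ U ⟩ ∋ Q
    closure-closed {U} {Q} s∈I t =
      tabulate-∋ (Saturation.lfp-closed _ (U , Q) (Equivalence.from Bool.T-∨ (inj₂ (by-rule s∈I t))))

    mutual
      introduced : Word → StateSet
      introduced []      = atε
      introduced (γ ∷ w) = push γ (provable w)

      provable : Word → StateSet
      provable w = closure ⟨ introduced w ⟩

    provable-sound : ∀ w → Sound (provable w) w
    provable-sound w = closure-sound (introduced-sound w)
      where
        introduced-sound : ∀ w → Sound (introduced w) w
        introduced-sound []      = atε-sound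
        introduced-sound (γ ∷ w) = push-sound γ (provable-sound w)

    Provable : Config → Set
    Provable (P , w) = provable w ∋ P

    rule-complete : ∀ {s} → s ∈ I → ∀ σ → All (λ a → Provable (inst σ a)) (premises (toRule s)) →
                    Provable (inst σ (concl (toRule s)))
    rule-complete {introγ ps γ Q} s∈I σ prems = closure-extends (tabulate-∋
      (by-rule s∈I (∧-intro (≟-refl γ) (∧-intro (≟-refl Q) (All.all⁻ (Vec.lookup (provable σ)) (All.map⁻ prems))))))
    rule-complete {introε Q} s∈I σ [] = closure-extends (tabulate-∋ (by-rule s∈I (≟-refl Q)))
    rule-complete {neutral ps Q} s∈I σ prems =
      closure-closed s∈I (∧-intro (≟-refl Q) (All.all⁻ _ (All.map ∋-tabulate (All.map⁻ prems))))
    rule-complete {elim P₁ γ ps Q} s∈I σ (prem₁ ∷ prems) =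
      closure-closed s∈I (∧-intro (≟-refl Q)
        (∧-intro (∋-tabulate prem₁) (All.all⁻ _ (All.map ∋-tabulate (All.map⁻ prems)))))

    provable-complete : ∀ {C} → Proof J C → Provable C
    provable-complete (node r r∈J σ subproofs) with ∈-map⁻ toRule r∈J
    ... | s , s∈I , refl =
      rule-complete s∈I σ (All-fromIndexed _ (λ i → provable-complete (subproofs i)))

    decide : ∀ C → Dec (Proof J C)
    decide (P , w) = map′ (provable-sound w P) provable-complete (T? (Vec.lookup (provable w) P))

    _·_ : Subst → Word → Word
    x≔ε    · σ = []
    x≔γx γ · σ = γ ∷ σ

    inst-substA : ∀ sb σ a → inst σ (substA sb a) ≡ inst (sb · σ) a
    inst-substA sb       σ (P , cl w) = refl
    inst-substA x≔ε      σ (P , ap w) = cong (P ,_) (sym (++-identityʳ w))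
    inst-substA (x≔γx γ) σ (P , ap w) = cong (P ,_) (++-assoc w [ γ ] σ)

    allSubst-complete : ∀ sb → sb ∈ allSubst
    allSubst-complete x≔ε     = here refl
    allSubst-complete (x≔γx γ) = there (∈-map⁺ x≔γx (∈-allFin γ))

    substituted-sound : ∀ {s} → s ∈ I → ∀ sb σ → All (λ a → Proof J (inst σ a)) (premises (substR sb (toRule s))) →
                        Proof J (inst σ (concl (substR sb (toRule s))))
    substituted-sound {s} s∈I sb σ prems =
      subst (Proof J) (sym (inst-substA sb σ (concl (toRule s))))
        (infer s∈I (sb · σ) (All.map (λ {a} → subst (Proof J) (inst-substA sb σ a)) (All.map⁻ prems)))

    tilde-sound : ∀ {r} → r ∈ tilde I → ∀ σ → All (λ a → Proof J (inst σ a)) (premises r) → Proof J (inst σ (concl r))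
    tilde-sound r∈ σ prems with find (∈-concatMap⁻ tildeR r∈)
    ... | introγ _ _ _ , s∈I , here refl = infer s∈I σ prems
    ... | introε _ , s∈I , here refl = infer s∈I σ prems
    ... | s@(elim _ _ _ _) , s∈I , r∈s with ∈-map⁻ (λ sb → substR sb (toRule s)) r∈s
    ...   | sb , _ , refl = substituted-sound s∈I sb σ prems
    tilde-sound r∈ σ prems | s@(neutral _ _) , s∈I , r∈s with ∈-map⁻ (λ sb → substR sb (toRule s)) r∈s
    ...   | sb , _ , refl = substituted-sound s∈I sb σ prems

    data Shape : Atom → Set where
      ε-shape : ∀ P → Shape (P , cl [])
      γ-shape : ∀ P γ → Shape (P , ap [ γ ])

    𝒞-shape : ∀ {B} → B ∈ 𝒞 → Shape B
    𝒞-shape B∈ with find (∈-concatMap⁻ _ {xs = allFin nS} B∈)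
    ... | P , _ , here refl = ε-shape P
    ... | P , _ , there B∈γ with ∈-map⁻ (λ γ → P , ap [ γ ]) B∈γ
    ...   | γ , _ , refl = γ-shape P γ

    shape-𝒞 : ∀ {B} → Shape B → B ∈ 𝒞
    shape-𝒞 (ε-shape P)   = ∈-concatMap⁺ _ (lose (∈-allFin P) (here refl))
    shape-𝒞 (γ-shape P γ) = ∈-concatMap⁺ _ (lose (∈-allFin P) (there (∈-map⁺ (λ γ → P , ap [ γ ]) (∈-allFin γ))))

    PremisesAmong : Rule → Word → Rule → Word → Set
    PremisesAmong r σ r₀ σ₀ = ∀ {a} → a ∈ premises r → ∃ λ a₀ → a₀ ∈ premises r₀ × inst σ a ≡ inst σ₀ a₀

    Covering : SRule → Atom → Word → Word → Set
    Covering s B σ σ₀ = ∃ λ r → r ∈ tildeR s × concl r ≡ B × PremisesAmong r σ (toRule s) σ₀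

    substituted-covers : ∀ s → tildeR s ≡ map (λ sb → substR sb (toRule s)) allSubst →
                         ∀ sb σ → Covering s (substA sb (concl (toRule s))) σ (sb · σ)
    substituted-covers s tildeR-s sb σ =
      substR sb (toRule s) ,
      subst (substR sb (toRule s) ∈_) (sym tildeR-s) (∈-map⁺ (λ sb → substR sb (toRule s)) (allSubst-complete sb)) ,
      refl , premises-among
      where
        premises-among : PremisesAmong (substR sb (toRule s)) σ (toRule s) (sb · σ)
        premises-among a∈ with ∈-map⁻ (substA sb) a∈
        ... | a₀ , a₀∈ , refl = a₀ , a₀∈ , inst-substA sb σ a₀

    tilde-covers : ∀ s {B} → Shape B → ∀ σ σ₀ → inst σ B ≡ inst σ₀ (concl (toRule s)) → Covering s B σ σ₀
    tilde-covers (introγ ps γ Q) (ε-shape P)   σ σ₀ ()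
    tilde-covers (introγ ps γ Q) (γ-shape P _) σ σ₀ refl = toRule (introγ ps γ Q) , here refl , refl , λ {a} a∈ → a , a∈ , refl
    tilde-covers (introε Q)      (ε-shape P)   σ σ₀ refl = toRule (introε Q) , here refl , refl , λ ()
    tilde-covers (introε Q)      (γ-shape P γ) σ σ₀ ()
    tilde-covers s@(elim _ _ _ _) (ε-shape P)   σ _ refl = substituted-covers s refl x≔ε σ
    tilde-covers s@(elim _ _ _ _) (γ-shape P γ) σ _ refl = substituted-covers s refl (x≔γx γ) σ
    tilde-covers s@(neutral _ _)  (ε-shape P)   σ _ refl = substituted-covers s refl x≔ε σ
    tilde-covers s@(neutral _ _)  (γ-shape P γ) σ _ refl = substituted-covers s refl (x≔γx γ) σ

    Ī : System
    Ī = complement I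

    rulesFor : Atom → List Rule
    rulesFor B = filter (λ r → concl r ≟A B) (tilde I)

    complement-rule : ∀ {r} → r ∈ Ī →
      ∃ λ B → B ∈ 𝒞 × ∃ λ ps → ps ∈ choices (map premises (rulesFor B)) × r ≡ mkRule ps B
    complement-rule r∈ with find (∈-concatMap⁻ _ {xs = 𝒞} r∈)
    ... | B , B∈ , r∈B with ∈-map⁻ (λ ps → mkRule ps B) r∈B
    ...   | ps , ps∈ , r≡ = B , B∈ , ps , ps∈ , r≡

    complement-meets : ∀ {r r′} → r ∈ Ī → r′ ∈ tilde I → concl r′ ≡ concl r →
                       ∃ λ a → a ∈ premises r′ × a ∈ premises r
    complement-meets r∈ r′∈ same-concl with complement-rule r∈
    ... | B , _ , ps , ps∈ , refl =
      choice-meets (map premises (rulesFor B)) ps∈ (∈-map⁺ premises (∈-filter⁺ (λ r → concl r ≟A B) r′∈ same-concl))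

    complement-complete : ∀ {B} {P : Atom → Set} → B ∈ 𝒞 →
                          (∀ {r} → r ∈ tilde I → concl r ≡ B → ∃ λ a → a ∈ premises r × P a) →
                          ∃ λ ps → mkRule ps B ∈ Ī × All P ps
    complement-complete {B} {P} B∈ meets =
      let ps , ps∈ , all-P = choices-complete (map premises (rulesFor B)) (All.map⁺ (All.tabulate meets-listed))
      in ps , ∈-concatMap⁺ _ (lose B∈ (∈-map⁺ (λ ps → mkRule ps B) ps∈)) , all-P
      where
        meets-listed : ∀ {r} → r ∈ rulesFor B → ∃ λ a → a ∈ premises r × P a
        meets-listed r∈ = let r∈tilde , same-concl = ∈-filter⁻ (λ r → concl r ≟A B) r∈ in meets r∈tilde same-concl

    complement-concl : ∀ {r} → r ∈ Ī → concl r ∈ 𝒞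
    complement-concl r∈ with complement-rule r∈
    ... | B , B∈ , ps , _ , refl = B∈

    complement-blocks : ∀ {r s} → r ∈ Ī → s ∈ I → ∀ σ σ₀ → inst σ (concl r) ≡ inst σ₀ (concl (toRule s)) →
                        ∃ λ a → a ∈ premises r × ∃ λ a₀ → a₀ ∈ premises (toRule s) × inst σ a ≡ inst σ₀ a₀
    complement-blocks {r} {s} r∈ s∈I σ σ₀ concl≡ = from-covering (tilde-covers s (𝒞-shape (complement-concl r∈)) σ σ₀ concl≡)
      where
        from-covering : Covering s (concl r) σ σ₀ →
                        ∃ λ a → a ∈ premises r × ∃ λ a₀ → a₀ ∈ premises (toRule s) × inst σ a ≡ inst σ₀ a₀
        from-covering (r′ , r′∈s , same-concl , among) =
          let a , a∈r′ , a∈r = complement-meets r∈ (∈-concatMap⁺ tildeR (lose s∈I r′∈s)) same-concl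
          in a , a∈r , among a∈r′

    inst-lookup : ∀ σ {a} {as : List Atom} (a∈ : a ∈ as) → inst σ (lookup as (index a∈)) ≡ inst σ a
    inst-lookup σ a∈ = cong (inst σ) (sym (lookup-index a∈))

    module Refutation {A : Config} (cp : CoProof Ī A) where
      open CoProof cp renaming (subst to σ-at)

      premise-below : ∀ {s} → s ∈ I → ∀ σ₀ n → label n ≡ inst σ₀ (concl (toRule s)) →
                      ∃ λ j → ∃ λ i → label (child n i) ≡ inst σ₀ (lookup (premises (toRule s)) j)
      premise-below {s} s∈I σ₀ n label≡ =
        from-blocks (complement-blocks (ruleIn n) s∈I (σ-at n) σ₀ (trans (sym (nodeLabel n)) label≡))
        where
          from-blocks : (∃ λ a → a ∈ premises (rule n) × ∃ λ a₀ → a₀ ∈ premises (toRule s) × inst (σ-at n) a ≡ inst σ₀ a₀) →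
                        ∃ λ j → ∃ λ i → label (child n i) ≡ inst σ₀ (lookup (premises (toRule s)) j)
          from-blocks (a , a∈n , a₀ , a₀∈ , inst≡) = index a₀∈ , index a∈n , (begin
            label (child n (index a∈n))                            ≡⟨ childLabel n (index a∈n) ⟩
            inst (σ-at n) (lookup (premises (rule n)) (index a∈n)) ≡⟨ inst-lookup (σ-at n) a∈n ⟩
            inst (σ-at n) a                                        ≡⟨ inst≡ ⟩
            inst σ₀ a₀                                             ≡⟨ sym (inst-lookup σ₀ a₀∈) ⟩
            inst σ₀ (lookup (premises (toRule s)) (index a₀∈))     ∎)
            where open ≡-Reasoning

      unprovable : ∀ {C} → Proof J C → ∀ n → label n ≡ C → ⊥
      unprovable (node r r∈J σ₀ subproofs) n label≡ with ∈-map⁻ toRule r∈J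
      ... | s , s∈I , refl = descend (premise-below s∈I σ₀ n label≡)
        where
          descend : (∃ λ j → ∃ λ i → label (child n i) ≡ inst σ₀ (lookup (premises (toRule s)) j)) → ⊥
          descend (j , i , child≡) = unprovable (subproofs j) (child n i) child≡

      refutes : ¬ Proof J A
      refutes p = unprovable p root rootLabel

    pattern-of : Config → Atom
    pattern-of (P , [])    = P , cl []
    pattern-of (P , γ ∷ w) = P , ap [ γ ]

    rest-of : Config → Word
    rest-of (P , [])    = []
    rest-of (P , γ ∷ w) = w

    pattern-inst : ∀ C → inst (rest-of C) (pattern-of C) ≡ C
    pattern-inst (P , [])    = refl
    pattern-inst (P , γ ∷ w) = refl

    pattern-∈𝒞 : ∀ C → pattern-of C ∈ 𝒞
    pattern-∈𝒞 (P , [])    = shape-𝒞 (ε-shape P)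
    pattern-∈𝒞 (P , γ ∷ w) = shape-𝒞 (γ-shape P γ)

    unprovable-premise : ∀ {C r} → ¬ Proof J C → r ∈ tilde I → concl r ≡ pattern-of C →
                         ∃ λ a → a ∈ premises r × ¬ Proof J (inst (rest-of C) a)
    unprovable-premise {C} {r} ¬proof r∈ same-concl =
      find (¬All⇒Any¬ (λ a → decide (inst (rest-of C) a)) (premises r) (λ prems → ¬proof
        (subst (Proof J) (trans (cong (inst (rest-of C)) same-concl) (pattern-inst C)) (tilde-sound r∈ (rest-of C) prems))))

    Unprovable : Set
    Unprovable = Σ Config (λ C → ¬ Proof J C)

    next : (n : Unprovable) → ∃ λ ps → mkRule ps (pattern-of (proj₁ n)) ∈ Ī ×
                                        All (λ a → ¬ Proof J (inst (rest-of (proj₁ n)) a)) ps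
    next (C , ¬proof) = complement-complete (pattern-∈𝒞 C) (unprovable-premise ¬proof)

    coproof : ∀ {A} → ¬ Proof J A → CoProof Ī A
    coproof {A} ¬proof = record
      { Node       = Unprovable
      ; root       = A , ¬proof
      ; label      = proj₁
      ; rule       = λ n → mkRule (proj₁ (next n)) (pattern-of (proj₁ n))
      ; ruleIn     = λ n → proj₁ (proj₂ (next n))
      ; subst      = λ n → rest-of (proj₁ n)
      ; child      = λ n i → inst (rest-of (proj₁ n)) (lookup (proj₁ (next n)) i) ,
                             All.lookup (proj₂ (proj₂ (next n))) (∈-lookup i)
      ; rootLabel  = refl
      ; nodeLabel  = λ n → sym (pattern-inst (proj₁ n))
      ; childLabel = λ n i → refl
      }

theorem2 : (nS nG : ℕ) (I : APDS.SmallStepAPDS nS nG) (A : APDS.Config nS nG) →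
    APDS.CoProof nS nG (APDS.complement nS nG I) A ⇔ (¬ APDS.Proof nS nG (APDS.⟦_⟧ nS nG I) A)
theorem2 nS nG I A = mk⇔ (Refutation.refutes I) (coproof I)
  where open Complementation nS nG
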